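{- Let $p, q$ be distinct odd prime numbers and $n, m, k$ positive integers. Then $Cl_2(\mathbb{Z}_{p^n} \times \mathbb{Z}_k) \cong Cl_2(\mathbb{Z}_{q^m} \times \mathbb{Z}_k)$ if and only if $p^n - p^{n-1} = q^m - q^{m-1}$. Furthermore, if $n > 1$, then $Cl_2(\mathbb{Z}_{p^n} \times \mathbb{Z}_k) \cong Cl_2(\mathbb{Z}_{q^m} \times \mathbb{Z}_k)$ if and only if $q = p^n - p^{n-1} + 1$ (which is then a prime number) and $m = 1$.
   Context: For a ring $R$ with identity, $Id(R)$ denotes the set of idempotents and $U(R)$ the set of units of $R$. The clean graph $Cl(R)$ has vertex set $Id(R) \times U(R)$, and two distinct vertices $(e,u)$ and $(f,v)$ are adjacent if and only if $ef=fe=0$ or $uv=vu=1$. $Cl_2(R)$ is the induced subgraph of $Cl(R)$ on $\{(e,u): e \in Id(R)\setminus\{0\},\ u \in U(R)\}$. Products of rings are direct products. $\cong$ denotes graph isomorphism. -}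

module Defs where

open import Level using (0ℓ)
open import Data.Nat using (ℕ; NonZero; _+_; _*_; _%_; _^_; _>_)
open import Data.Nat.Base using (>-nonZero; >-nonZero⁻¹)
open import Data.Nat.Properties using (m^n≢0)
open import Data.Nat.DivMod using (m%n<n)
open import Data.Nat.Primality using (Prime; prime⇒nonZero)
open import Data.Fin using (Fin; toℕ; fromℕ<)
open import Data.Product using (Σ; _×_; _,_)
open import Data.Sum using (_⊎_)
open import Relation.Nullary using (¬_)
open import Relation.Binary.PropositionalEquality using (_≡_)
open import Function.Bundles using (_⤖_; Bijection; _⇔_)

-- Concrete (raw) rings with identity, equality being _≡_.
-- Only the operations are recorded; the instances below are genuine
-- commutative rings with identity.

record RingStr : Set₁ where
  field
    Carrier : Set
    _+r_    : Carrier → Carrier → Carrier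
    _*r_    : Carrier → Carrier → Carrier
    0#      : Carrier
    1#      : Carrier

Zmod : (N : ℕ) → .{{NonZero N}} → RingStr
Zmod N = record
  { Carrier = Fin N
  ; _+r_    = λ a b → fromℕ< (m%n<n (toℕ a + toℕ b) N)
  ; _*r_    = λ a b → fromℕ< (m%n<n (toℕ a * toℕ b) N)
  ; 0#      = fromℕ< {0} (>-nonZero⁻¹ N)
  ; 1#      = fromℕ< (m%n<n 1 N)
  }

_×R_ : RingStr → RingStr → RingStr
R ×R S = record
  { Carrier = R.Carrier × S.Carrier
  ; _+r_    = λ { (a , b) (c , d) → (a R.+r c , b S.+r d) }
  ; _*r_    = λ { (a , b) (c , d) → (a R.*r c , b S.*r d) }
  ; 0#      = (R.0# , S.0#)
  ; 1#      = (R.1# , S.1#)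
  }
  where
    module R = RingStr R
    module S = RingStr S

record Graph : Set₁ where
  field
    V   : Set
    Adj : V → V → Set

_≅_ : Graph → Graph → Set
G ≅ H = Σ (G.V ⤖ H.V) λ f →
          ∀ x y → G.Adj x y ⇔ H.Adj (Bijection.to f x) (Bijection.to f y)
  where
    module G = Graph G
    module H = Graph H

module _ (R : RingStr) where
  open RingStr R

  IsIdempotent : Carrier → Set
  IsIdempotent e = e *r e ≡ e

  IsUnit : Carrier → Set
  IsUnit u = Σ Carrier λ v → (u *r v ≡ 1#) × (v *r u ≡ 1#)

  -- Vertices of Cl₂(R): pairs (e , u) with e a nonzero idempotent and
  -- u a unit.  The proofs are irrelevant, so a vertex is determined by
  -- the pair (e , u).
  record Cl₂Vertex : Set where
    constructor vtx
    field
      idem : Carrier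
      unit : Carrier
      .isIdem    : IsIdempotent idem
      .isNonzero : ¬ (idem ≡ 0#)
      .isUnit    : IsUnit unit

  Cl₂Adj : Cl₂Vertex → Cl₂Vertex → Set
  Cl₂Adj x y =
    ¬ (x ≡ y) ×
    (((e *r f ≡ 0#) × (f *r e ≡ 0#)) ⊎ ((u *r v ≡ 1#) × (v *r u ≡ 1#)))
    where
      e = Cl₂Vertex.idem x
      u = Cl₂Vertex.unit x
      f = Cl₂Vertex.idem y
      v = Cl₂Vertex.unit y

  Cl₂ : Graph
  Cl₂ = record { V = Cl₂Vertex ; Adj = Cl₂Adj }

prime^≢0 : ∀ {p} → Prime p → (n : ℕ) → NonZero (p ^ n)
prime^≢0 {p} pp n = m^n≢0 p n {{prime⇒nonZero pp}}

ZpnZk : (p n k : ℕ) → Prime p → k > 0 → RingStr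
ZpnZk p n k pp k>0 =
  Zmod (p ^ n) {{prime^≢0 pp n}} ×R Zmod k {{>-nonZero k>0}}

{-# OPTIONS --safe #-}
module Submission where

-- A vertex of Cl₂(ℤ_N × S) is a nonzero idempotent (e , s) together with a unit (u , v).
-- For N = p ^ n the ring ℤ_N has only the idempotents 0 and 1, so e only records whether it
-- is zero and the idempotent part of the graph is the same as for 𝔽₂ × S.  Hence
-- Cl₂(ℤ_N × S) depends on ℤ_N only through its unit graph, which joins u to u⁻¹, i.e. the
-- functional graph of inversion on U(ℤ_N).  Counting vertices, an isomorphism of clean
-- graphs forces |U(ℤ_{p^n})| = |U(ℤ_{q^m})|, that is equal totients.  Conversely, for odd p
-- the involution u ↦ u⁻¹ of U(ℤ_{p^n}) fixes exactly ±1 and pairs up the remaining units,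
-- so its functional graph is determined by |U(ℤ_{p^n})|, and equal totients give an
-- isomorphism.  Finally, if n > 1 then p divides φ(p^n); were also m > 1, q would divide the
-- same number and p < q < p, so m = 1 and q = φ(p^n) + 1.

open import Defs
open import Data.Bool using (Bool; true; false; not; _xor_; _∧_)
open import Data.Bool.Properties using (∧-idem) renaming (_≟_ to _≟ᵇ_)
open import Data.Empty using (⊥-elim-irr)
open import Data.Fin using (Fin; zero; suc; toℕ; fromℕ<; cast; combine)
open import Data.Fin.Permutation using (↔⇒≡)
open import Data.Fin.Properties
  using (toℕ-fromℕ<; toℕ-injective; toℕ<n; any?; toℕ-cast; cast-involutive; toℕ-combine;
         +↔⊎; *↔×; 2↔Bool; nonZeroIndex)
  renaming (_≟_ to _≟ᶠ_)
open import Data.Irrelevant using ([_])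
open import Data.Nat
  using (ℕ; zero; suc; _+_; _*_; _∸_; _^_; _<_; _≤_; _>_; _%_; _/_; NonZero; s≤s; z≤n;
         >-nonZero; >-nonZero⁻¹; nonTrivial⇒n>1)
open import Data.Nat.Coprimality using (Coprime; coprime-divisor; coprime-Bézout) renaming (sym to coprime-sym)
open import Data.Nat.Divisibility
  using (_∣_; divides; _∣?_; ∣-refl; ∣-trans; ∣⇒≤; >⇒∤; ∣1⇒≡1; m∣m*n; ∣m⇒∣m*n;
         ∣m+n∣m⇒∣n; %-presˡ-∣)
open import Data.Nat.DivMod
  using (m≡m%n+[m/n]*n; m%n%n≡m%n; %-distribˡ-*; [m+kn]%n≡m%n; m<n⇒m%n≡m; m%n<n)
open import Data.Nat.GCD using (module Bézout)
open import Data.Nat.Primality using (Prime; prime⇒irreducible; prime⇒nonZero; prime⇒nonTrivial)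
open import Data.Nat.Properties
  using (_≟_; _<?_; suc-injective; <-cmp; <-irrefl; <-asym; <-trans; <⇒≤; <⇒≱; ≤-antisym;
         n<1+n; 0≢1+n; 1+n≢0;
         +-comm; +-identityʳ; +-cancelˡ-≡; m+n∸n≡m; m∸n+n≡m; m<n⇒0<n∸m; ∸-monoʳ-<;
         *-comm; *-assoc; *-identityʳ; *-cancelˡ-≡; *-distribˡ-∸; *-mono-≤; m^n≢0; m^n>0;
         module ≤-Reasoning)
open import Data.Nat.Tactic.RingSolver using (solve-∀)
open import Data.Product using (Σ; _×_; _,_; proj₁; proj₂)
open import Data.Product.Function.NonDependent.Propositional using (_×-↔_; _×-⇔_)
open import Data.Product.Properties using (×-≡,≡→≡; ×-≡,≡←≡; ≡-dec)
open import Data.Refinement using (Refinement-syntax; _,_; value)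
open import Data.Refinement.Properties using (value-injective)
open import Data.Sum using (_⊎_; inj₁; inj₂) renaming (map to ⊎-map)
open import Data.Sum.Function.Propositional using (_⊎-↔_; _⊎-⇔_)
open import Data.Unit using (⊤; tt)
open import Function using (_∘_)
open import Function.Bundles using (_↔_; Inverse; Injection; Equivalence; mk↔ₛ′; _⇔_; mk⇔)
open import Function.Construct.Composition using (_⇔-∘_)
open import Function.Construct.Symmetry using (⇔-sym)
open import Function.Properties.Bijection using (⤖⇒↔)
open import Function.Properties.Inverse using (↔-refl; ↔-sym; ↔-trans; ↔⇒⤖; ↔⇒↣)
open import Function.Related.Propositional using (module EquationalReasoning)
open import Relation.Binary.Definitions using (tri<; tri≈; tri>)
open import Relation.Binary.PropositionalEquality
  using (_≡_; _≢_; refl; sym; trans; cong; cong₂; subst; subst₂; module ≡-Reasoning)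
open import Relation.Nullary using (¬_; Dec; yes; no; does; recompute; contradiction)
open import Relation.Nullary.Decidable using (_×-dec_; ¬?; dec-true; dec-false)
open import Relation.Unary using (Decidable)

open Inverse using (to; from; strictlyInverseˡ; strictlyInverseʳ)

private
  variable
    A B : Set
    n : ℕ
    F G H K : Graph

-- Finite types

Finite : Set → Set
Finite A = Σ ℕ λ n → A ↔ Fin n

refinement-cong : {P : A → Set} {Q : B → Set} (h : A ↔ B) →
  (∀ a → P a ⇔ Q (to h a)) → [ a ∈ A ∣ P a ] ↔ [ b ∈ B ∣ Q b ]
refinement-cong {Q = Q} h P⇔Q = mk↔ₛ′
  (λ { (a , [ pa ]) → to h a , [ Equivalence.to (P⇔Q a) pa ] })
  (λ { (b , [ qb ]) → from h b ,
        [ Equivalence.from (P⇔Q (from h b)) (subst Q (sym (strictlyInverseˡ h b)) qb) ] })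
  (λ _ → value-injective (strictlyInverseˡ h _))
  (λ _ → value-injective (strictlyInverseʳ h _))

refinement-suc : {P : Fin (suc n) → Set} →
  [ i ∈ Fin (suc n) ∣ P i ] ↔ ([ _ ∈ ⊤ ∣ P zero ] ⊎ [ i ∈ Fin n ∣ P (suc i) ])
refinement-suc = mk↔ₛ′
  (λ { (zero , p) → inj₁ (tt , p) ; (suc i , p) → inj₂ (i , p) })
  (λ { (inj₁ (tt , p)) → zero , p ; (inj₂ (i , p)) → suc i , p })
  (λ { (inj₁ _) → refl ; (inj₂ _) → refl })
  (λ { (zero , _) → refl ; (suc _ , _) → refl })

refinement-×ʳ : {P : B → Set} → [ ab ∈ A × B ∣ P (proj₂ ab) ] ↔ (A × [ b ∈ B ∣ P b ])
refinement-×ʳ = mk↔ₛ′ (λ ((a , b) , p) → a , b , p) (λ (a , b , p) → (a , b) , p)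
  (λ _ → refl) (λ _ → refl)

proposition-finite : {Q : Set} → Dec Q → Finite [ _ ∈ ⊤ ∣ Q ]
proposition-finite (yes q) = 1 , mk↔ₛ′ (λ _ → zero) (λ _ → tt , [ q ])
  (λ { zero → refl }) (λ _ → refl)
proposition-finite (no ¬q) = 0 , mk↔ₛ′ (λ { (_ , [ q ]) → ⊥-elim-irr (¬q q) }) (λ ()) (λ ())
  (λ { (_ , [ q ]) → ⊥-elim-irr (¬q q) })

finite-⊎ : Finite A → Finite B → Finite (A ⊎ B)
finite-⊎ (m , f) (n , g) = m + n , ↔-trans (f ⊎-↔ g) (↔-sym +↔⊎)

finite-× : Finite A → Finite B → Finite (A × B)
finite-× (m , f) (n , g) = m * n , ↔-trans (f ×-↔ g) (↔-sym *↔×)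

Fin-refinement-finite : ∀ n {P : Fin n → Set} → Decidable P → Finite [ i ∈ Fin n ∣ P i ]
Fin-refinement-finite zero    P? = 0 , mk↔ₛ′ (λ { (() , _) }) (λ ()) (λ ()) (λ { (() , _) })
Fin-refinement-finite (suc n) P?
  with c , h ← finite-⊎ (proposition-finite (P? zero)) (Fin-refinement-finite n (P? ∘ suc))
  = c , ↔-trans refinement-suc h

refinement-finite : {P : A → Set} → Finite A → Decidable P → Finite [ a ∈ A ∣ P a ]
refinement-finite {P = P} (n , h) P? with c , g ← Fin-refinement-finite n (P? ∘ from h)
  = c , ↔-trans (refinement-cong h λ a → mk⇔ (subst P (sym (strictlyInverseʳ h a)))
                                              (subst P (strictlyInverseʳ h a))) g

nonzero-↔ : ∀ m → [ j ∈ Fin m ∣ toℕ j ≢ 0 ] ↔ Fin (m ∸ 1)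
nonzero-↔ zero    = mk↔ₛ′ (λ { (() , _) }) (λ ()) (λ ()) (λ { (() , _) })
nonzero-↔ (suc m) = mk↔ₛ′
  (λ { (zero , [ 0≢0 ]) → ⊥-elim-irr (0≢0 refl) ; (suc j , _) → j })
  (λ j → suc j , [ (λ ()) ])
  (λ _ → refl)
  (λ { (zero , [ 0≢0 ]) → ⊥-elim-irr (0≢0 refl) ; (suc j , _) → refl })

×-cancelˡ-finite : {W : Set} {a b : ℕ} → Finite W → W → (W × Fin a) ↔ (W × Fin b) → a ≡ b
×-cancelˡ-finite {W} {a} {b} (c , h) w e = *-cancelˡ-≡ a b c {{nonZeroIndex (to h w)}} (↔⇒≡ (begin
  Fin (c * a)      ↔⟨ *↔× ⟩
  (Fin c × Fin a)  ↔⟨ h ×-↔ ↔-refl ⟨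
  (W × Fin a)      ↔⟨ e ⟩
  (W × Fin b)      ↔⟨ h ×-↔ ↔-refl ⟩
  (Fin c × Fin b)  ↔⟨ *↔× ⟨
  Fin (c * b)      ∎))
  where open EquationalReasoning

-- Graph isomorphisms

module _ where
  open Graph

  mk≅ : (h : V G ↔ V H) → (∀ x y → Adj G x y ⇔ Adj H (to h x) (to h y)) → G ≅ H
  mk≅ h adj = ↔⇒⤖ h , adj

  ≅-refl : G ≅ G
  ≅-refl {G} = mk≅ {G} {G} ↔-refl λ _ _ → mk⇔ (λ a → a) (λ a → a)

  ≅-sym : G ≅ H → H ≅ G
  ≅-sym {G} {H} (f , adj) = mk≅ {H} {G} (↔-sym h) λ x y →
    ⇔-sym (subst₂ (λ x′ y′ → Adj G (from h x) (from h y) ⇔ Adj H x′ y′)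
                  (strictlyInverseˡ h x) (strictlyInverseˡ h y) (adj (from h x) (from h y)))
    where
    h : V G ↔ V H
    h = ⤖⇒↔ f

  ≅-trans : F ≅ G → G ≅ H → F ≅ H
  ≅-trans {F} {G} {H} (f , adjf) (g , adjg) = mk≅ {F} {H} (↔-trans (⤖⇒↔ f) (⤖⇒↔ g))
    λ x y → adjg _ _ ⇔-∘ adjf x y

  -- G ≅ H unfolds to a Σ-type from which G and H cannot be recovered, so chains are
  -- assembled in a record type, whose indices unification can read off.
  module ≅-Reasoning where

    record _IsoChain_ (G H : Graph) : Set₁ where
      constructor chain
      field iso : G ≅ H

    infix  1 begin_
    infixr 2 _≅⟨_⟩_ _≅⟨_⟨_
    infix  3 _∎

    begin_ : G IsoChain H → G ≅ H
    begin chain iso = iso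

    _≅⟨_⟩_ : (F : Graph) {G H : Graph} → F ≅ G → G IsoChain H → F IsoChain H
    _≅⟨_⟩_ F {G} {H} f (chain g) = chain (≅-trans {F} {G} {H} f g)

    _≅⟨_⟨_ : (F : Graph) {G H : Graph} → G ≅ F → G IsoChain H → F IsoChain H
    _≅⟨_⟨_ F {G} {H} f (chain g) = chain (≅-trans {F} {G} {H} (≅-sym {G} {F} f) g)

    _∎ : (G : Graph) → G IsoChain G
    G ∎ = chain (≅-refl {G})

  _⊠_ : Graph → Graph → Graph
  G ⊠ H = record { V = V G × V H ; Adj = λ { (x , y) (x′ , y′) → Adj G x x′ × Adj H y y′ } }

  ⊠-cong : F ≅ G → H ≅ K → (F ⊠ H) ≅ (G ⊠ K)
  ⊠-cong {F} {G} {H} {K} (f , adjf) (g , adjg) = mk≅ {F ⊠ H} {G ⊠ K} (⤖⇒↔ f ×-↔ ⤖⇒↔ g)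
    λ { (x , y) (x′ , y′) → adjf x x′ ×-⇔ adjg y y′ }

-- Involutions

functionalGraph : {A : Set} → (A → A) → Graph
functionalGraph {A} f = record { V = A ; Adj = λ a b → b ≡ f a }

functionalGraph-≅ : {f : A → A} {g : B → B} (h : A ↔ B) →
  (∀ a → to h (f a) ≡ g (to h a)) → functionalGraph f ≅ functionalGraph g
functionalGraph-≅ {f = f} {g} h comm = mk≅ {functionalGraph f} {functionalGraph g} h λ a b → mk⇔
  (λ { refl → comm a })
  (λ hb≡gha → Injection.injective (↔⇒↣ h) (trans hb≡gha (sym (comm a))))

Orbits : Set → Set → Set
Orbits F L = F ⊎ (Bool × L)

swapOrbit : {F L : Set} → Orbits F L → Orbits F L
swapOrbit (inj₁ x)       = inj₁ x
swapOrbit (inj₂ (b , l)) = inj₂ (not b , l)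

orbits-≅ : {F F′ L L′ : Set} → F ↔ F′ → L ↔ L′ →
  functionalGraph (swapOrbit {F} {L}) ≅ functionalGraph (swapOrbit {F′} {L′})
orbits-≅ f l = functionalGraph-≅ {f = swapOrbit} {g = swapOrbit} (f ⊎-↔ (↔-refl ×-↔ l))
  λ { (inj₁ _) → refl ; (inj₂ _) → refl }

orbits-finite : {F L : Set} (f : Finite F) (l : Finite L) → Orbits F L ↔ Fin (proj₁ f + 2 * proj₁ l)
orbits-finite f l = proj₂ (finite-⊎ f (finite-× (2 , ↔-sym 2↔Bool) l))

-- A two-element orbit {a , σ a} is represented by its element of smaller rank; the Bool
-- records whether a is that element (false) or its image (true).
module OrbitDecomposition {A : Set} (σ : A → A) (σ-involutive : ∀ a → σ (σ a) ≡ a)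
                          (rank : A → ℕ) (rank-injective : ∀ {a b} → rank a ≡ rank b → a ≡ b)
                          where

  Fixed : Set
  Fixed = [ a ∈ A ∣ σ a ≡ a ]

  Lower : Set
  Lower = [ a ∈ A ∣ rank a < rank (σ a) ]

  private
    rank-σσ : ∀ a → rank (σ (σ a)) ≡ rank a
    rank-σσ a = cong rank (σ-involutive a)

  split : A → Orbits Fixed Lower
  split a with <-cmp (rank a) (rank (σ a))
  ... | tri< a<σa _ _ = inj₂ (false , a , [ a<σa ])
  ... | tri≈ _ a≡σa _ = inj₁ (a , [ rank-injective (sym a≡σa) ])
  ... | tri> _ _ σa<a = inj₂ (true , σ a , [ subst (rank (σ a) <_) (sym (rank-σσ a)) σa<a ])

  merge : Orbits Fixed Lower → A
  merge (inj₁ (a , _))         = a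
  merge (inj₂ (false , a , _)) = a
  merge (inj₂ (true , a , _))  = σ a

  merge-split : ∀ a → merge (split a) ≡ a
  merge-split a with <-cmp (rank a) (rank (σ a))
  ... | tri< _ _ _ = refl
  ... | tri≈ _ _ _ = refl
  ... | tri> _ _ _ = σ-involutive a

  split-merge : ∀ o → split (merge o) ≡ o
  split-merge (inj₁ (a , [ σa≡a ])) with <-cmp (rank a) (rank (σ a))
  ... | tri< a<σa _ _ = ⊥-elim-irr (<-irrefl (cong rank (sym σa≡a)) a<σa)
  ... | tri≈ _ _ _    = refl
  ... | tri> _ _ σa<a = ⊥-elim-irr (<-irrefl (cong rank σa≡a) σa<a)
  split-merge (inj₂ (false , a , [ a<σa ])) with <-cmp (rank a) (rank (σ a))
  ... | tri< _ _ _    = refl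
  ... | tri≈ _ a≡σa _ = ⊥-elim-irr (<-irrefl a≡σa a<σa)
  ... | tri> _ _ σa<a = ⊥-elim-irr (<-asym a<σa σa<a)
  split-merge (inj₂ (true , a , [ a<σa ])) with <-cmp (rank (σ a)) (rank (σ (σ a)))
  ... | tri< σa<σσa _ _ = ⊥-elim-irr (<-asym a<σa (subst (rank (σ a) <_) (rank-σσ a) σa<σσa))
  ... | tri≈ _ σa≡σσa _ = ⊥-elim-irr (<-irrefl (sym (trans σa≡σσa (rank-σσ a))) a<σa)
  ... | tri> _ _ _      = cong (λ l → inj₂ (true , l)) (value-injective (σ-involutive a))

  merge-swapOrbit : ∀ o → merge (swapOrbit o) ≡ σ (merge o)
  merge-swapOrbit (inj₁ (a , [ σa≡a ])) =
    rank-injective (recompute (rank a ≟ rank (σ a)) (cong rank (sym σa≡a)))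
  merge-swapOrbit (inj₂ (false , _))    = refl
  merge-swapOrbit (inj₂ (true , a , _)) = sym (σ-involutive a)

  orbitDecomposition : A ↔ Orbits Fixed Lower
  orbitDecomposition = mk↔ₛ′ split merge split-merge merge-split

  split-σ : ∀ a → split (σ a) ≡ swapOrbit (split a)
  split-σ a = begin
    split (σ a)                           ≡⟨ cong (split ∘ σ) (merge-split a) ⟨
    split (σ (merge (split a)))           ≡⟨ cong split (merge-swapOrbit (split a)) ⟨
    split (merge (swapOrbit (split a)))   ≡⟨ split-merge (swapOrbit (split a)) ⟩
    swapOrbit (split a)                   ∎
    where open ≡-Reasoning

  functionalGraph-≅-orbits : functionalGraph σ ≅ functionalGraph (swapOrbit {Fixed} {Lower})
  functionalGraph-≅-orbits = functionalGraph-≅ {f = σ} {g = swapOrbit} orbitDecomposition split-σ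

-- Clean graphs

module _ (R : RingStr) where
  open RingStr R

  Orthogonal : Carrier → Carrier → Set
  Orthogonal e f = (e *r f ≡ 0#) × (f *r e ≡ 0#)

  MutuallyInverse : Carrier → Carrier → Set
  MutuallyInverse u v = (u *r v ≡ 1#) × (v *r u ≡ 1#)

  idempotentGraph : Graph
  idempotentGraph = record
    { V   = [ e ∈ Carrier ∣ IsIdempotent R e × ¬ e ≡ 0# ]
    ; Adj = λ e f → Orthogonal (value e) (value f)
    }

  unitGraph : Graph
  unitGraph = record
    { V   = [ u ∈ Carrier ∣ IsUnit R u ]
    ; Adj = λ u v → MutuallyInverse (value u) (value v)
    }

  cl₂Vertex-↔ : Cl₂Vertex R ↔ (Graph.V idempotentGraph × Graph.V unitGraph)
  cl₂Vertex-↔ = mk↔ₛ′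
    (λ (vtx e u idem nonzero unit) → (e , [ idem , nonzero ]) , (u , [ unit ]))
    (λ ((e , [ p ]) , (u , [ unit ])) → vtx e u (proj₁ p) (proj₂ p) unit)
    (λ _ → refl) (λ _ → refl)

cl₂-cong : {R S : RingStr} → idempotentGraph R ≅ idempotentGraph S → unitGraph R ≅ unitGraph S →
  Cl₂ R ≅ Cl₂ S
cl₂-cong {R} {S} (α , adjα) (β , adjβ) = mk≅ {Cl₂ R} {Cl₂ S} h λ x y →
  mk⇔ (λ x≢y → x≢y ∘ Injection.injective (↔⇒↣ h) {x} {y}) (λ hx≢hy → hx≢hy ∘ cong (to h))
    ×-⇔ (adjα _ _ ⊎-⇔ adjβ _ _)
  where
  h : Cl₂Vertex R ↔ Cl₂Vertex S
  h = ↔-trans (cl₂Vertex-↔ R) (↔-trans (⤖⇒↔ α ×-↔ ⤖⇒↔ β) (↔-sym (cl₂Vertex-↔ S)))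

module _ {R S : RingStr} where
  open RingStr using (Carrier)

  mutuallyInverse-×R : {u v : Carrier R} {u′ v′ : Carrier S} →
    MutuallyInverse (R ×R S) (u , u′) (v , v′) ⇔ (MutuallyInverse R u v × MutuallyInverse S u′ v′)
  mutuallyInverse-×R = mk⇔
    (λ (uv≡1 , vu≡1) → (proj₁ (×-≡,≡←≡ uv≡1) , proj₁ (×-≡,≡←≡ vu≡1)) ,
                        (proj₂ (×-≡,≡←≡ uv≡1) , proj₂ (×-≡,≡←≡ vu≡1)))
    (λ ((uv≡1 , vu≡1) , (uv≡1′ , vu≡1′)) →
      ×-≡,≡→≡ (uv≡1 , uv≡1′) , ×-≡,≡→≡ (vu≡1 , vu≡1′))

  isUnit-×R : {u : Carrier R} {u′ : Carrier S} →
    IsUnit (R ×R S) (u , u′) ⇔ (IsUnit R u × IsUnit S u′)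
  isUnit-×R = mk⇔
    (λ ((v , v′) , inv) → let (inv₁ , inv₂) = Equivalence.to mutuallyInverse-×R inv
                          in (v , inv₁) , (v′ , inv₂))
    (λ ((v , inv₁) , (v′ , inv₂)) → (v , v′) , Equivalence.from mutuallyInverse-×R (inv₁ , inv₂))

  unitGraph-×R : unitGraph (R ×R S) ≅ (unitGraph R ⊠ unitGraph S)
  unitGraph-×R = mk≅ {unitGraph (R ×R S)} {unitGraph R ⊠ unitGraph S} h λ _ _ → mutuallyInverse-×R
    where
    h : Graph.V (unitGraph (R ×R S)) ↔ (Graph.V (unitGraph R) × Graph.V (unitGraph S))
    h = mk↔ₛ′
      (λ ((u , u′) , [ unit ]) → (u  , [ proj₁ (Equivalence.to isUnit-×R unit) ]) ,
                                  (u′ , [ proj₂ (Equivalence.to isUnit-×R unit) ]))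
      (λ ((u , [ unit ]) , (u′ , [ unit′ ])) →
        (u , u′) , [ Equivalence.from isUnit-×R (unit , unit′) ])
      (λ _ → refl) (λ _ → refl)

𝔽₂ : RingStr
𝔽₂ = record { Carrier = Bool ; _+r_ = _xor_ ; _*r_ = _∧_ ; 0# = false ; 1# = true }

Cofactor : RingStr → Set
Cofactor S = Graph.V (idempotentGraph (𝔽₂ ×R S)) × Graph.V (unitGraph S)

-- Arithmetic modulo prime powers

square-suc : ∀ m → suc m * suc m ≡ 1 + m * (2 + m)
square-suc = solve-∀

[m+n]%d≡m⇒d∣n : ∀ m n d .{{_ : NonZero d}} → (m + n) % d ≡ m → d ∣ n
[m+n]%d≡m⇒d∣n m n d eq = divides ((m + n) / d) (+-cancelˡ-≡ m n _ (begin
  m + n                          ≡⟨ m≡m%n+[m/n]*n (m + n) d ⟩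
  (m + n) % d + (m + n) / d * d  ≡⟨ cong (_+ (m + n) / d * d) eq ⟩
  m + (m + n) / d * d            ∎))
  where open ≡-Reasoning

m<n∧n∣m⇒m≡0 : ∀ {m n} → m < n → n ∣ m → m ≡ 0
m<n∧n∣m⇒m≡0 {zero}  _   _   = refl
m<n∧n∣m⇒m≡0 {suc m} m<n n∣m = contradiction n∣m (>⇒∤ m<n)

∣*+⇔≡0 : ∀ {d} m {r} → r < d → d ∣ d * m + r ⇔ r ≡ 0
∣*+⇔≡0 {d} m r<d = mk⇔
  (λ d∣dm+r → m<n∧n∣m⇒m≡0 r<d (∣m+n∣m⇒∣n d∣dm+r (m∣m*n m)))
  (λ { refl → subst (d ∣_) (sym (+-identityʳ (d * m))) (m∣m*n m) })

[n∸1]²%n≡1 : ∀ {n} .{{_ : NonZero n}} → 1 < n → ((n ∸ 1) * (n ∸ 1)) % n ≡ 1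
[n∸1]²%n≡1 {suc zero}    (s≤s ())
[n∸1]²%n≡1 {suc (suc m)} _ = begin
  (suc m * suc m) % (2 + m)     ≡⟨ cong (_% (2 + m)) (square-suc m) ⟩
  (1 + m * (2 + m)) % (2 + m)   ≡⟨ [m+kn]%n≡m%n 1 m (2 + m) ⟩
  1                             ∎
  where open ≡-Reasoning

bézout⇒inverse-mod : ∀ {N u} .{{_ : NonZero N}} → 1 < N → Bézout.Identity 1 u N →
  Σ ℕ λ v → (u * v) % N ≡ 1
bézout⇒inverse-mod {N} {u} 1<N (Bézout.+- x y 1+yN≡xu) = x , (begin
  (u * x) % N       ≡⟨ cong (_% N) (trans (*-comm u x) (sym 1+yN≡xu)) ⟩
  (1 + y * N) % N   ≡⟨ [m+kn]%n≡m%n 1 y N ⟩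
  1 % N             ≡⟨ m<n⇒m%n≡m 1<N ⟩
  1                 ∎)
  where open ≡-Reasoning
-- Here x * u ≡ -1 modulo N, so (N - 1) * x inverts u.
bézout⇒inverse-mod {suc M} {u} 1<N (Bézout.-+ x y 1+xu≡yN) = M * x , (begin
  (u * (M * x)) % N                 ≡⟨ [m+kn]%n≡m%n (u * (M * x)) y N ⟨
  (u * (M * x) + y * N) % N         ≡⟨ cong (λ k → (u * (M * x) + k) % N) 1+xu≡yN ⟨
  (u * (M * x) + (1 + x * u)) % N   ≡⟨ cong (_% N) (regroup M u x) ⟩
  (1 + (x * u) * N) % N             ≡⟨ [m+kn]%n≡m%n 1 (x * u) N ⟩
  1 % N                             ≡⟨ m<n⇒m%n≡m 1<N ⟩
  1                                 ∎)
  where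
  N : ℕ
  N = suc M
  open ≡-Reasoning
  regroup : ∀ M u x → u * (M * x) + (1 + x * u) ≡ 1 + (x * u) * suc M
  regroup = solve-∀

module PrimePower {p : ℕ} (p-prime : Prime p) where

  instance
    p-nonZero : NonZero p
    p-nonZero = prime⇒nonZero p-prime

  1<p : 1 < p
  1<p = nonTrivial⇒n>1 p {{prime⇒nonTrivial p-prime}}

  p∤1 : ¬ p ∣ 1
  p∤1 p∣1 = <⇒≱ 1<p (∣⇒≤ p∣1)

  ∤-consecutive : ∀ m → ¬ (p ∣ m × p ∣ suc m)
  ∤-consecutive m (p∣m , p∣1+m) = p∤1 (∣m+n∣m⇒∣n (subst (p ∣_) (+-comm 1 m) p∣1+m) p∣m)

  coprime-^ : ∀ n {a} → ¬ p ∣ a → Coprime a (p ^ n)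
  coprime-^ zero    _   (_ , i∣1) = ∣1⇒≡1 i∣1
  coprime-^ (suc n) {a} p∤a {i} (i∣a , i∣p*p^n) =
    coprime-^ n p∤a (i∣a , coprime-divisor i⊥p i∣p*p^n)
    where
    i⊥p : Coprime i p
    i⊥p {j} (j∣i , j∣p) with prime⇒irreducible p-prime j∣p
    ... | inj₁ j≡1  = j≡1
    ... | inj₂ refl = contradiction (∣-trans j∣i i∣a) p∤a

  ^∣*-split : ∀ n {a b} → ¬ (p ∣ a × p ∣ b) → p ^ n ∣ a * b → p ^ n ∣ a ⊎ p ^ n ∣ b
  ^∣*-split n {a} {b} ¬both p^n∣ab with p ∣? a
  ... | yes p∣a = inj₁ (coprime-divisor (coprime-sym (coprime-^ n λ p∣b → ¬both (p∣a , p∣b)))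
                                         (subst (p ^ n ∣_) (*-comm a b) p^n∣ab))
  ... | no p∤a  = inj₂ (coprime-divisor (coprime-sym (coprime-^ n p∤a)) p^n∣ab)

  odd-∤-u∧2+u : ¬ 2 ∣ p → ∀ u → ¬ (p ∣ u × p ∣ 2 + u)
  odd-∤-u∧2+u p-odd u (p∣u , p∣2+u) = p-odd (subst (_∣ p) (≤-antisym (∣⇒≤ p∣2) 1<p) ∣-refl)
    where
    p∣2 : p ∣ 2
    p∣2 = ∣m+n∣m⇒∣n (subst (p ∣_) (+-comm 2 u) p∣2+u) p∣u

  module _ (n : ℕ) where
    instance
      p^n-nonZero : NonZero (p ^ n)
      p^n-nonZero = m^n≢0 p n

      p^[1+n]-nonZero : NonZero (p ^ suc n)
      p^[1+n]-nonZero = m^n≢0 p (suc n)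

    idempotent-mod-^ : ∀ {e} → e < p ^ n → (e * e) % p ^ n ≡ e → e ≡ 0 ⊎ e ≡ 1
    idempotent-mod-^ {zero}  _     _    = inj₁ refl
    idempotent-mod-^ {suc e} 1+e<N ee≡e
      with ^∣*-split n (∤-consecutive e) ([m+n]%d≡m⇒d∣n (suc e) (e * suc e) (p ^ n) ee≡e)
    ... | inj₁ N∣e   = inj₂ (cong suc (m<n∧n∣m⇒m≡0 (<-trans (n<1+n e) 1+e<N) N∣e))
    ... | inj₂ N∣1+e = contradiction N∣1+e (>⇒∤ 1+e<N)

    square≡1-mod-^ : ¬ 2 ∣ p → ∀ {u} → u < p ^ n → (u * u) % p ^ n ≡ 1 →
      u ≡ 1 ⊎ suc u ≡ p ^ n
    square≡1-mod-^ _ {zero} _ 0≡1 = contradiction (trans (sym (m<n⇒m%n≡m (m^n>0 p n))) 0≡1) 0≢1+n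
    square≡1-mod-^ p-odd {suc u} 1+u<N uu≡1
      with ^∣*-split n (odd-∤-u∧2+u p-odd u)
             ([m+n]%d≡m⇒d∣n 1 (u * (2 + u)) (p ^ n)
               (subst (λ k → k % p ^ n ≡ 1) (square-suc u) uu≡1))
    ... | inj₁ N∣u   = inj₁ (cong suc (m<n∧n∣m⇒m≡0 (<-trans (n<1+n u) 1+u<N) N∣u))
    ... | inj₂ N∣2+u = inj₂ (≤-antisym 1+u<N (∣⇒≤ N∣2+u))

    inverse-mod-^⇒∤ : ∀ {u v} → (u * v) % p ^ suc n ≡ 1 → ¬ p ∣ u
    inverse-mod-^⇒∤ {u} {v} uv≡1 p∣u =
      p∤1 (subst (p ∣_) uv≡1 (%-presˡ-∣ (∣m⇒∣m*n v p∣u) (m∣m*n (p ^ n))))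

    ∤⇒inverse-mod-^ : ∀ {u} → ¬ p ∣ u → Σ ℕ λ v → (u * v) % p ^ suc n ≡ 1
    ∤⇒inverse-mod-^ p∤u =
      bézout⇒inverse-mod (*-mono-≤ 1<p (m^n>0 p n)) (coprime-Bézout (coprime-^ (suc n) p∤u))

-- The rings ℤ_N

module ZmodArithmetic (N : ℕ) .{{_ : NonZero N}} where
  open RingStr (Zmod N)

  toℕ-* : ∀ a b → toℕ (a *r b) ≡ (toℕ a * toℕ b) % N
  toℕ-* a b = toℕ-fromℕ< _

  toℕ-0# : toℕ 0# ≡ 0
  toℕ-0# = toℕ-fromℕ< _

  toℕ-1# : toℕ 1# ≡ 1 % N
  toℕ-1# = toℕ-fromℕ< _

  1<N⇒toℕ-1#≡1 : 1 < N → toℕ 1# ≡ 1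
  1<N⇒toℕ-1#≡1 1<N = trans toℕ-1# (m<n⇒m%n≡m 1<N)

  1#≢0# : 1 < N → 1# ≢ 0#
  1#≢0# 1<N 1≡0 = 1+n≢0 (trans (sym (1<N⇒toℕ-1#≡1 1<N)) (trans (cong toℕ 1≡0) toℕ-0#))

  %-absorbʳ-* : ∀ m n → (m * (n % N)) % N ≡ (m * n) % N
  %-absorbʳ-* m n = begin
    (m * (n % N)) % N            ≡⟨ %-distribˡ-* m (n % N) N ⟩
    ((m % N) * (n % N % N)) % N  ≡⟨ cong (λ k → ((m % N) * k) % N) (m%n%n≡m%n n N) ⟩
    ((m % N) * (n % N)) % N      ≡⟨ %-distribˡ-* m n N ⟨
    (m * n) % N                  ∎
    where open ≡-Reasoning

  %-absorbˡ-* : ∀ m n → ((m % N) * n) % N ≡ (m * n) % N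
  %-absorbˡ-* m n = begin
    ((m % N) * n) % N  ≡⟨ cong (_% N) (*-comm (m % N) n) ⟩
    (n * (m % N)) % N  ≡⟨ %-absorbʳ-* n m ⟩
    (n * m) % N        ≡⟨ cong (_% N) (*-comm n m) ⟩
    (m * n) % N        ∎
    where open ≡-Reasoning

  *r-comm : ∀ a b → a *r b ≡ b *r a
  *r-comm a b = toℕ-injective (begin
    toℕ (a *r b)           ≡⟨ toℕ-* a b ⟩
    (toℕ a * toℕ b) % N    ≡⟨ cong (_% N) (*-comm (toℕ a) (toℕ b)) ⟩
    (toℕ b * toℕ a) % N    ≡⟨ toℕ-* b a ⟨
    toℕ (b *r a)           ∎)
    where open ≡-Reasoning

  *r-assoc : ∀ a b c → (a *r b) *r c ≡ a *r (b *r c)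
  *r-assoc a b c = toℕ-injective (begin
    toℕ ((a *r b) *r c)                   ≡⟨ toℕ-* (a *r b) c ⟩
    (toℕ (a *r b) * toℕ c) % N            ≡⟨ cong (λ k → (k * toℕ c) % N) (toℕ-* a b) ⟩
    (((toℕ a * toℕ b) % N) * toℕ c) % N   ≡⟨ %-absorbˡ-* (toℕ a * toℕ b) (toℕ c) ⟩
    (toℕ a * toℕ b * toℕ c) % N           ≡⟨ cong (_% N) (*-assoc (toℕ a) (toℕ b) (toℕ c)) ⟩
    (toℕ a * (toℕ b * toℕ c)) % N         ≡⟨ %-absorbʳ-* (toℕ a) (toℕ b * toℕ c) ⟨
    (toℕ a * ((toℕ b * toℕ c) % N)) % N   ≡⟨ cong (λ k → (toℕ a * k) % N) (toℕ-* b c) ⟨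
    (toℕ a * toℕ (b *r c)) % N            ≡⟨ toℕ-* a (b *r c) ⟨
    toℕ (a *r (b *r c))                   ∎)
    where open ≡-Reasoning

  *r-identityʳ : ∀ a → a *r 1# ≡ a
  *r-identityʳ a = toℕ-injective (begin
    toℕ (a *r 1#)             ≡⟨ toℕ-* a 1# ⟩
    (toℕ a * toℕ 1#) % N      ≡⟨ cong (λ k → (toℕ a * k) % N) toℕ-1# ⟩
    (toℕ a * (1 % N)) % N     ≡⟨ %-absorbʳ-* (toℕ a) 1 ⟩
    (toℕ a * 1) % N           ≡⟨ cong (_% N) (*-identityʳ (toℕ a)) ⟩
    toℕ a % N                 ≡⟨ m<n⇒m%n≡m (toℕ<n a) ⟩
    toℕ a                     ∎)
    where open ≡-Reasoning

  *r-zeroˡ : ∀ a → 0# *r a ≡ 0#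
  *r-zeroˡ a = toℕ-injective (begin
    toℕ (0# *r a)          ≡⟨ toℕ-* 0# a ⟩
    (toℕ 0# * toℕ a) % N   ≡⟨ cong (λ k → (k * toℕ a) % N) toℕ-0# ⟩
    0 % N                  ≡⟨ m<n⇒m%n≡m (>-nonZero⁻¹ N) ⟩
    0                      ≡⟨ toℕ-0# ⟨
    toℕ 0#                 ∎)
    where open ≡-Reasoning

  *r-zeroʳ : ∀ a → a *r 0# ≡ 0#
  *r-zeroʳ a = trans (*r-comm a 0#) (*r-zeroˡ a)

  inverse-unique : ∀ {a b c} → a *r b ≡ 1# → a *r c ≡ 1# → b ≡ c
  inverse-unique {a} {b} {c} ab≡1 ac≡1 = begin
    b               ≡⟨ *r-identityʳ b ⟨
    b *r 1#         ≡⟨ cong (b *r_) ac≡1 ⟨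
    b *r (a *r c)   ≡⟨ *r-assoc b a c ⟨
    (b *r a) *r c   ≡⟨ cong (_*r c) (trans (*r-comm b a) ab≡1) ⟩
    1# *r c         ≡⟨ *r-comm 1# c ⟩
    c *r 1#         ≡⟨ *r-identityʳ c ⟩
    c               ∎
    where open ≡-Reasoning

  isUnit⇒inverse-mod : 1 < N → ∀ {u} → IsUnit (Zmod N) u → Σ ℕ λ v → (toℕ u * v) % N ≡ 1
  isUnit⇒inverse-mod 1<N {u} (v , uv≡1 , _) =
    toℕ v , trans (sym (toℕ-* u v)) (trans (cong toℕ uv≡1) (1<N⇒toℕ-1#≡1 1<N))

  inverse-mod⇒isUnit : 1 < N → ∀ u v → (toℕ u * v) % N ≡ 1 → IsUnit (Zmod N) u
  inverse-mod⇒isUnit 1<N u v uv%N≡1 = w , uw≡1 , trans (*r-comm w u) uw≡1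
    where
    w : Fin N
    w = fromℕ< (m%n<n v N)
    uw≡1 : u *r w ≡ 1#
    uw≡1 = toℕ-injective (begin
      toℕ (u *r w)             ≡⟨ toℕ-* u w ⟩
      (toℕ u * toℕ w) % N      ≡⟨ cong (λ k → (toℕ u * k) % N) (toℕ-fromℕ< _) ⟩
      (toℕ u * (v % N)) % N    ≡⟨ %-absorbʳ-* (toℕ u) v ⟩
      (toℕ u * v) % N          ≡⟨ uv%N≡1 ⟩
      1                        ≡⟨ 1<N⇒toℕ-1#≡1 1<N ⟨
      toℕ 1#                   ∎)
      where open ≡-Reasoning

  isUnit? : Decidable (IsUnit (Zmod N))
  isUnit? u = any? λ v → (u *r v ≟ᶠ 1#) ×-dec (v *r u ≟ᶠ 1#)

module ZmodUnits (N : ℕ) .{{_ : NonZero N}} where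
  open RingStr (Zmod N)
  open ZmodArithmetic N

  Unit : Set
  Unit = Graph.V (unitGraph (Zmod N))

  private
    inverse : (u : Unit) → IsUnit (Zmod N) (value u)
    inverse (u , [ unit ]) = recompute (isUnit? u) unit

  _⁻¹ : Unit → Unit
  u ⁻¹ = proj₁ (inverse u) , [ value u , proj₂ (proj₂ (inverse u)) , proj₁ (proj₂ (inverse u)) ]

  *-inverseʳ : ∀ u → value u *r value (u ⁻¹) ≡ 1#
  *-inverseʳ u = proj₁ (proj₂ (inverse u))

  mutuallyInverse⇔≡⁻¹ : ∀ u v → MutuallyInverse (Zmod N) (value u) (value v) ⇔ v ≡ u ⁻¹
  mutuallyInverse⇔≡⁻¹ u v = mk⇔
    (λ (uv≡1 , _) → value-injective (inverse-unique {value u} uv≡1 (*-inverseʳ u)))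
    (λ { refl → *-inverseʳ u , trans (*r-comm _ (value u)) (*-inverseʳ u) })

  ⁻¹-involutive : ∀ u → (u ⁻¹) ⁻¹ ≡ u
  ⁻¹-involutive u = sym (Equivalence.to (mutuallyInverse⇔≡⁻¹ (u ⁻¹) u)
    (trans (*r-comm _ (value u)) (*-inverseʳ u) , *-inverseʳ u))

  ⁻¹≡⇔square≡1 : ∀ u → u ⁻¹ ≡ u ⇔ value u *r value u ≡ 1#
  ⁻¹≡⇔square≡1 u = mk⇔
    (λ u⁻¹≡u → subst (λ v → value u *r value v ≡ 1#) u⁻¹≡u (*-inverseʳ u))
    (λ uu≡1 → sym (Equivalence.to (mutuallyInverse⇔≡⁻¹ u u) (uu≡1 , uu≡1)))

  unitGraph-≅-⁻¹ : unitGraph (Zmod N) ≅ functionalGraph _⁻¹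
  unitGraph-≅-⁻¹ = mk≅ {unitGraph (Zmod N)} {functionalGraph _⁻¹} ↔-refl mutuallyInverse⇔≡⁻¹

TrivialIdempotents : (N : ℕ) .{{_ : NonZero N}} → Set
TrivialIdempotents N =
  ∀ e → IsIdempotent (Zmod N) e → e ≡ RingStr.0# (Zmod N) ⊎ e ≡ RingStr.1# (Zmod N)

module ZmodIdempotents (N : ℕ) .{{_ : NonZero N}} (1<N : 1 < N) (trivial : TrivialIdempotents N) where
  open RingStr (Zmod N)
  open ZmodArithmetic N

  bit : Bool → Fin N
  bit false = 0#
  bit true  = 1#

  isNonzero : Fin N → Bool
  isNonzero e = not (does (e ≟ᶠ 0#))

  bit-isNonzero : ∀ e → .(IsIdempotent (Zmod N) e) → bit (isNonzero e) ≡ e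
  bit-isNonzero e idem with e ≟ᶠ 0# | trivial e (recompute (e *r e ≟ᶠ e) idem)
  ... | yes e≡0 | _        = sym e≡0
  ... | no e≢0  | inj₁ e≡0 = contradiction e≡0 e≢0
  ... | no _    | inj₂ e≡1 = sym e≡1

  isNonzero-bit : ∀ b → isNonzero (bit b) ≡ b
  isNonzero-bit false = cong not (dec-true (0# ≟ᶠ 0#) refl)
  isNonzero-bit true  = cong not (dec-false (1# ≟ᶠ 0#) (1#≢0# 1<N))

  bit-* : ∀ b c → bit b *r bit c ≡ bit (b ∧ c)
  bit-* false c     = *r-zeroˡ (bit c)
  bit-* true  false = *r-zeroʳ 1#
  bit-* true  true  = *r-identityʳ 1#

  bit≡0#⇔ : ∀ b → bit b ≡ 0# ⇔ b ≡ false
  bit≡0#⇔ false = mk⇔ (λ _ → refl) (λ _ → refl)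
  bit≡0#⇔ true  = mk⇔ (λ 1≡0 → contradiction 1≡0 (1#≢0# 1<N)) (λ ())

  idempotent≡0#⇔ : ∀ e → .(IsIdempotent (Zmod N) e) → e ≡ 0# ⇔ isNonzero e ≡ false
  idempotent≡0#⇔ e idem =
    bit≡0#⇔ (isNonzero e) ⇔-∘ mk⇔ (trans (bit-isNonzero e idem)) (trans (sym (bit-isNonzero e idem)))

  idempotent-*≡0#⇔ : ∀ e f → .(IsIdempotent (Zmod N) e) → .(IsIdempotent (Zmod N) f) →
    e *r f ≡ 0# ⇔ isNonzero e ∧ isNonzero f ≡ false
  idempotent-*≡0#⇔ e f e-idem f-idem =
    bit≡0#⇔ (isNonzero e ∧ isNonzero f) ⇔-∘ mk⇔ (trans (sym ef≡bit)) (trans ef≡bit)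
    where
    ef≡bit : e *r f ≡ bit (isNonzero e ∧ isNonzero f)
    ef≡bit = trans (cong₂ _*r_ (sym (bit-isNonzero e e-idem)) (sym (bit-isNonzero f f-idem)))
                   (bit-* (isNonzero e) (isNonzero f))

  idempotentGraph-≅-𝔽₂ : (S : RingStr) →
    idempotentGraph (Zmod N ×R S) ≅ idempotentGraph (𝔽₂ ×R S)
  idempotentGraph-≅-𝔽₂ S = mk≅ {idempotentGraph (Zmod N ×R S)} {idempotentGraph (𝔽₂ ×R S)} h adj
    where
    ,≡,-⇔ˡ : {A A′ B : Set} {a a₀ : A} {a′ a′₀ : A′} {b b₀ : B} → a ≡ a₀ ⇔ a′ ≡ a′₀ →
      (a , b) ≡ (a₀ , b₀) ⇔ (a′ , b) ≡ (a′₀ , b₀)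
    ,≡,-⇔ˡ a⇔a′ = mk⇔
      (λ eq → ×-≡,≡→≡ (Equivalence.to a⇔a′ (proj₁ (×-≡,≡←≡ eq)) , proj₂ (×-≡,≡←≡ eq)))
      (λ eq → ×-≡,≡→≡ (Equivalence.from a⇔a′ (proj₁ (×-≡,≡←≡ eq)) , proj₂ (×-≡,≡←≡ eq)))

    module S = RingStr S

    idempotent₁ : ∀ {e s} → IsIdempotent (Zmod N ×R S) (e , s) → IsIdempotent (Zmod N) e
    idempotent₁ = proj₁ ∘ ×-≡,≡←≡

    toBit : ∀ e s → IsIdempotent (Zmod N ×R S) (e , s) × (e , s) ≢ (0# , S.0#) →
      IsIdempotent (𝔽₂ ×R S) (isNonzero e , s) × (isNonzero e , s) ≢ (false , S.0#)
    toBit e s (idem , nonzero) =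
      ×-≡,≡→≡ (∧-idem (isNonzero e) , proj₂ (×-≡,≡←≡ idem)) ,
      nonzero ∘ Equivalence.from (,≡,-⇔ˡ (idempotent≡0#⇔ e (idempotent₁ idem)))

    fromBit : ∀ b s → IsIdempotent (𝔽₂ ×R S) (b , s) × (b , s) ≢ (false , S.0#) →
      IsIdempotent (Zmod N ×R S) (bit b , s) × (bit b , s) ≢ (0# , S.0#)
    fromBit b s (idem , nonzero) =
      ×-≡,≡→≡ (trans (bit-* b b) (cong bit (∧-idem b)) , proj₂ (×-≡,≡←≡ idem)) ,
      nonzero ∘ Equivalence.to (,≡,-⇔ˡ (bit≡0#⇔ b))

    h : Graph.V (idempotentGraph (Zmod N ×R S)) ↔ Graph.V (idempotentGraph (𝔽₂ ×R S))
    h = mk↔ₛ′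
      (λ ((e , s) , [ p ]) → (isNonzero e , s) , [ toBit e s p ])
      (λ ((b , s) , [ p ]) → (bit b , s) , [ fromBit b s p ])
      (λ ((b , s) , _) → value-injective (cong (_, s) (isNonzero-bit b)))
      (λ ((e , s) , [ p ]) → value-injective (cong (_, s) (bit-isNonzero e (idempotent₁ (proj₁ p)))))

    adj : ∀ x y → Orthogonal (Zmod N ×R S) (value x) (value y) ⇔
                  Orthogonal (𝔽₂ ×R S) (value (to h x)) (value (to h y))
    adj ((e , _) , [ p ]) ((f , _) , [ q ]) =
      ,≡,-⇔ˡ (idempotent-*≡0#⇔ e f (idempotent₁ (proj₁ p)) (idempotent₁ (proj₁ q))) ×-⇔
      ,≡,-⇔ˡ (idempotent-*≡0#⇔ f e (idempotent₁ (proj₁ q)) (idempotent₁ (proj₁ p)))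

  cl₂Vertex-↔-cofactor : (S : RingStr) {a : ℕ} → ZmodUnits.Unit N ↔ Fin a →
    Cl₂Vertex (Zmod N ×R S) ↔ (Cofactor S × Fin a)
  cl₂Vertex-↔-cofactor S {a} units = begin
    Cl₂Vertex (Zmod N ×R S)
      ↔⟨ cl₂Vertex-↔ (Zmod N ×R S) ⟩
    (Graph.V (idempotentGraph (Zmod N ×R S)) × Graph.V (unitGraph (Zmod N ×R S)))
      ↔⟨ ⤖⇒↔ (proj₁ (idempotentGraph-≅-𝔽₂ S)) ×-↔ ⤖⇒↔ (proj₁ (unitGraph-×R {Zmod N} {S})) ⟩
    (Graph.V (idempotentGraph (𝔽₂ ×R S)) × (ZmodUnits.Unit N × Graph.V (unitGraph S)))
      ↔⟨ mk↔ₛ′ (λ (e , u , v) → (e , v) , to units u) (λ ((e , v) , i) → e , from units i , v)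
               (λ ((e , v) , i) → cong ((e , v) ,_) (strictlyInverseˡ units i))
               (λ (e , u , v) → cong (λ w → e , w , v) (strictlyInverseʳ units u)) ⟩
    (Cofactor S × Fin a) ∎
    where open EquationalReasoning

module _ {N N′ : ℕ} .{{_ : NonZero N}} .{{_ : NonZero N′}} (1<N : 1 < N) (1<N′ : 1 < N′)
         (trivial : TrivialIdempotents N) (trivial′ : TrivialIdempotents N′) where
  private
    module I  = ZmodIdempotents N  1<N  trivial
    module I′ = ZmodIdempotents N′ 1<N′ trivial′

  cl₂-×R-cong : (S : RingStr) → unitGraph (Zmod N) ≅ unitGraph (Zmod N′) →
    Cl₂ (Zmod N ×R S) ≅ Cl₂ (Zmod N′ ×R S)
  cl₂-×R-cong S units = cl₂-cong idempotents (begin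
    unitGraph (Zmod N ×R S)            ≅⟨ unitGraph-×R {Zmod N} {S} ⟩
    unitGraph (Zmod N) ⊠ unitGraph S   ≅⟨ ⊠-cong {unitGraph (Zmod N)} {unitGraph (Zmod N′)}
                                                 {unitGraph S} {unitGraph S} units (≅-refl {unitGraph S}) ⟩
    unitGraph (Zmod N′) ⊠ unitGraph S  ≅⟨ unitGraph-×R {Zmod N′} {S} ⟨
    unitGraph (Zmod N′ ×R S)           ∎)
    where
    open ≅-Reasoning
    idempotents : idempotentGraph (Zmod N ×R S) ≅ idempotentGraph (Zmod N′ ×R S)
    idempotents = begin
      idempotentGraph (Zmod N ×R S)    ≅⟨ I.idempotentGraph-≅-𝔽₂ S ⟩
      idempotentGraph (𝔽₂ ×R S)        ≅⟨ I′.idempotentGraph-≅-𝔽₂ S ⟨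
      idempotentGraph (Zmod N′ ×R S)   ∎

  cl₂-≅⇒unit-counts-≡ : (S : RingStr) → Finite (Cofactor S) → Cofactor S → ∀ {a b} →
    ZmodUnits.Unit N ↔ Fin a → ZmodUnits.Unit N′ ↔ Fin b →
    Cl₂ (Zmod N ×R S) ≅ Cl₂ (Zmod N′ ×R S) → a ≡ b
  cl₂-≅⇒unit-counts-≡ S cofactor-finite c units units′ (f , _) = ×-cancelˡ-finite cofactor-finite c
    (↔-trans (↔-sym (I.cl₂Vertex-↔-cofactor S units))
             (↔-trans (⤖⇒↔ f) (I′.cl₂Vertex-↔-cofactor S units′)))

module _ (k : ℕ) .{{_ : NonZero k}} where
  open RingStr (Zmod k)
  open ZmodArithmetic k

  cofactor-finite : Finite (Cofactor (Zmod k))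
  cofactor-finite = finite-×
    (refinement-finite (finite-× (2 , ↔-sym 2↔Bool) (k , ↔-refl)) λ e →
      ≡-dec _≟ᵇ_ _≟ᶠ_ (RingStr._*r_ (𝔽₂ ×R Zmod k) e e) e ×-dec ¬? (≡-dec _≟ᵇ_ _≟ᶠ_ e (false , 0#)))
    (refinement-finite (k , ↔-refl) isUnit?)

  cofactor : Cofactor (Zmod k)
  cofactor = ((true , 1#) , [ ×-≡,≡→≡ (refl , *r-identityʳ 1#) , (λ ()) ]) ,
             (1# , [ 1# , *r-identityʳ 1# , *r-identityʳ 1# ])

module ZmodPrimePower {p : ℕ} (p-prime : Prime p) (n : ℕ) where
  open PrimePower p-prime

  N : ℕ
  N = p ^ suc n

  instance
    N-nonZero : NonZero N
    N-nonZero = m^n≢0 p (suc n)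

  open RingStr (Zmod N)
  open ZmodArithmetic N
  open ZmodUnits N

  1<N : 1 < N
  1<N = *-mono-≤ 1<p (m^n>0 p n)

  trivialIdempotents : TrivialIdempotents N
  trivialIdempotents e ee≡e = ⊎-map
    (λ e≡0 → toℕ-injective (trans e≡0 (sym toℕ-0#)))
    (λ e≡1 → toℕ-injective (trans e≡1 (sym (1<N⇒toℕ-1#≡1 1<N))))
    (idempotent-mod-^ (suc n) (toℕ<n e) (trans (sym (toℕ-* e e)) (cong toℕ ee≡e)))

  isUnit⇔∤ : ∀ u → IsUnit (Zmod N) u ⇔ (¬ p ∣ toℕ u)
  isUnit⇔∤ u = mk⇔
    (λ unit → inverse-mod-^⇒∤ n (proj₂ (isUnit⇒inverse-mod 1<N unit)))
    (λ p∤u → let (v , uv≡1) = ∤⇒inverse-mod-^ n p∤u in inverse-mod⇒isUnit 1<N u v uv≡1)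

  units-↔ : Unit ↔ Fin (p ^ n * (p ∸ 1))
  units-↔ = begin
    Unit                                               ↔⟨ refinement-cong ↔-refl isUnit⇔∤ ⟩
    [ u ∈ Fin N ∣ ¬ p ∣ toℕ u ]                         ↔⟨ refinement-cong digits digit-criterion ⟨
    [ ij ∈ Fin (p ^ n) × Fin p ∣ toℕ (proj₂ ij) ≢ 0 ]  ↔⟨ refinement-×ʳ ⟩
    (Fin (p ^ n) × [ j ∈ Fin p ∣ toℕ j ≢ 0 ])          ↔⟨ ↔-refl ×-↔ nonzero-↔ p ⟩
    (Fin (p ^ n) × Fin (p ∸ 1))                        ↔⟨ *↔× ⟨
    Fin (p ^ n * (p ∸ 1))                              ∎
    where
    open EquationalReasoning
    digits : (Fin (p ^ n) × Fin p) ↔ Fin N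
    digits = ↔-trans (↔-sym *↔×)
      (mk↔ₛ′ (cast eq) (cast (sym eq)) (cast-involutive eq (sym eq)) (cast-involutive (sym eq) eq))
      where
      eq : p ^ n * p ≡ N
      eq = *-comm (p ^ n) p
    toℕ-digits : ∀ i j → toℕ (to digits (i , j)) ≡ p * toℕ i + toℕ j
    toℕ-digits i j = trans (toℕ-cast _ (combine i j)) (toℕ-combine i j)
    digit-criterion : ∀ ij → (toℕ (proj₂ ij) ≢ 0) ⇔ (¬ p ∣ toℕ (to digits ij))
    digit-criterion (i , j) = mk⇔
      (λ j≢0 p∣ → j≢0 (Equivalence.to digit≡0 (subst (p ∣_) (toℕ-digits i j) p∣)))
      (λ p∤ j≡0 → p∤ (subst (p ∣_) (sym (toℕ-digits i j)) (Equivalence.from digit≡0 j≡0)))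
      where
      digit≡0 : p ∣ p * toℕ i + toℕ j ⇔ toℕ j ≡ 0
      digit≡0 = ∣*+⇔≡0 (toℕ i) (toℕ<n j)

  module _ (p-odd : ¬ 2 ∣ p) where

    -1# : Fin N
    -1# = fromℕ< (∸-monoʳ-< {N} {1} {0} (s≤s z≤n) (<⇒≤ 1<N))

    toℕ--1# : toℕ -1# ≡ N ∸ 1
    toℕ--1# = toℕ-fromℕ< _

    square≡1⇒±1 : ∀ u → u *r u ≡ 1# → u ≡ 1# ⊎ u ≡ -1#
    square≡1⇒±1 u uu≡1 = ⊎-map
      (λ u≡1 → toℕ-injective (trans u≡1 (sym (1<N⇒toℕ-1#≡1 1<N))))
      (λ 1+u≡N → toℕ-injective (trans (cong (_∸ 1) 1+u≡N) (sym toℕ--1#)))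
      (square≡1-mod-^ (suc n) p-odd (toℕ<n u)
        (trans (sym (toℕ-* u u)) (trans (cong toℕ uu≡1) (1<N⇒toℕ-1#≡1 1<N))))

    -1²≡1 : -1# *r -1# ≡ 1#
    -1²≡1 = toℕ-injective (begin
      toℕ (-1# *r -1#)          ≡⟨ toℕ-* -1# -1# ⟩
      (toℕ -1# * toℕ -1#) % N   ≡⟨ cong (λ k → (k * k) % N) toℕ--1# ⟩
      ((N ∸ 1) * (N ∸ 1)) % N   ≡⟨ [n∸1]²%n≡1 1<N ⟩
      1                         ≡⟨ 1<N⇒toℕ-1#≡1 1<N ⟨
      toℕ 1#                    ∎)
      where open ≡-Reasoning

    -1#≢1# : -1# ≢ 1#
    -1#≢1# -1≡1 = p-odd (subst (_∣ p) p≡2 ∣-refl)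
      where
      N≡2 : N ≡ 2
      N≡2 = begin
        N           ≡⟨ m∸n+n≡m (<⇒≤ 1<N) ⟨
        N ∸ 1 + 1   ≡⟨ cong (_+ 1) toℕ--1# ⟨
        toℕ -1# + 1 ≡⟨ cong (λ u → toℕ u + 1) -1≡1 ⟩
        toℕ 1# + 1  ≡⟨ cong (_+ 1) (1<N⇒toℕ-1#≡1 1<N) ⟩
        2           ∎
        where open ≡-Reasoning
      p≡2 : p ≡ 2
      p≡2 = ≤-antisym (subst (p ≤_) N≡2 (∣⇒≤ (m∣m*n (p ^ n)))) 1<p

    open OrbitDecomposition _⁻¹ ⁻¹-involutive (toℕ ∘ value) (value-injective ∘ toℕ-injective)

    fixed-↔ : Fixed ↔ Bool
    fixed-↔ = mk↔ₛ′ isOne fixed isOne-fixed fixed-isOne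
      where
      one minusOne : Unit
      one      = 1#  , [ 1# , *r-identityʳ 1# , *r-identityʳ 1# ]
      minusOne = -1# , [ -1# , -1²≡1 , -1²≡1 ]

      fixed : Bool → Fixed
      fixed true  = one      , [ Equivalence.from (⁻¹≡⇔square≡1 one) (*r-identityʳ 1#) ]
      fixed false = minusOne , [ Equivalence.from (⁻¹≡⇔square≡1 minusOne) -1²≡1 ]

      isOne : Fixed → Bool
      isOne u = does (value (value u) ≟ᶠ 1#)

      isOne-fixed : ∀ b → isOne (fixed b) ≡ b
      isOne-fixed true  = dec-true (1# ≟ᶠ 1#) refl
      isOne-fixed false = dec-false (-1# ≟ᶠ 1#) -1#≢1#

      square≡1 : ∀ (u : Fixed) → value (value u) *r value (value u) ≡ 1#
      square≡1 (u , [ u⁻¹≡u ]) =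
        recompute (value u *r value u ≟ᶠ 1#) (Equivalence.to (⁻¹≡⇔square≡1 u) u⁻¹≡u)

      fixed-isOne : ∀ u → fixed (isOne u) ≡ u
      fixed-isOne u with value (value u) ≟ᶠ 1# | square≡1⇒±1 (value (value u)) (square≡1 u)
      ... | yes u≡1 | _         = value-injective (value-injective (sym u≡1))
      ... | no u≢1  | inj₁ u≡1  = contradiction u≡1 u≢1
      ... | no _    | inj₂ u≡-1 = value-injective (value-injective (sym u≡-1))

    unitGraph-≅-orbits : Σ ℕ λ l → (p ^ n * (p ∸ 1) ≡ 2 + 2 * l) ×
      (unitGraph (Zmod N) ≅ functionalGraph (swapOrbit {Bool} {Fin l}))
    unitGraph-≅-orbits = l , φ≡2+2l , (begin
      unitGraph (Zmod N)                           ≅⟨ unitGraph-≅-⁻¹ ⟩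
      functionalGraph _⁻¹                          ≅⟨ functionalGraph-≅-orbits ⟩
      functionalGraph (swapOrbit {Fixed} {Lower})  ≅⟨ orbits-≅ fixed-↔ (proj₂ lower-finite) ⟩
      functionalGraph (swapOrbit {Bool} {Fin l})   ∎)
      where
      open ≅-Reasoning
      lower-finite : Finite Lower
      lower-finite = refinement-finite (_ , units-↔) λ u → toℕ (value u) <? toℕ (value (u ⁻¹))
      l : ℕ
      l = proj₁ lower-finite
      φ≡2+2l : p ^ n * (p ∸ 1) ≡ 2 + 2 * l
      φ≡2+2l = ↔⇒≡ (↔-trans (↔-sym units-↔) (↔-trans orbitDecomposition
                   (orbits-finite (2 , ↔-trans fixed-↔ (↔-sym 2↔Bool)) lower-finite)))

unitGraph-≅ : ∀ {p q} (pp : Prime p) (qq : Prime q) → ¬ 2 ∣ p → ¬ 2 ∣ q → ∀ n m →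
  p ^ n * (p ∸ 1) ≡ q ^ m * (q ∸ 1) →
  unitGraph (Zmod (p ^ suc n) {{prime^≢0 pp (suc n)}}) ≅
  unitGraph (Zmod (q ^ suc m) {{prime^≢0 qq (suc m)}})
unitGraph-≅ {p} {q} pp qq p-odd q-odd n m φ≡φ =
  let l  , φ≡2+2l  , P≅ = ZmodPrimePower.unitGraph-≅-orbits pp n p-odd
      l′ , φ≡2+2l′ , Q≅ = ZmodPrimePower.unitGraph-≅-orbits qq m q-odd
      l≡l′ : l ≡ l′
      l≡l′ = *-cancelˡ-≡ l l′ 2 (+-cancelˡ-≡ 2 _ _ (trans (sym φ≡2+2l) (trans φ≡φ φ≡2+2l′)))
  in begin
  unitGraph (Zmod (p ^ suc n) {{prime^≢0 pp (suc n)}})  ≅⟨ P≅ ⟩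
  functionalGraph (swapOrbit {Bool} {Fin l})             ≅⟨ orbits-≅ ↔-refl (subst (Fin l ↔_) (cong Fin l≡l′) ↔-refl) ⟩
  functionalGraph (swapOrbit {Bool} {Fin l′})            ≅⟨ Q≅ ⟨
  unitGraph (Zmod (q ^ suc m) {{prime^≢0 qq (suc m)}})  ∎
  where open ≅-Reasoning

-- The totient equation

p^[1+n]∸p^n≡p^n*[p∸1] : ∀ p n → p ^ suc n ∸ p ^ n ≡ p ^ n * (p ∸ 1)
p^[1+n]∸p^n≡p^n*[p∸1] p n = begin
  p ^ suc n ∸ p ^ n       ≡⟨ cong₂ _∸_ (*-comm (p ^ n) p) (*-identityʳ (p ^ n)) ⟨
  p ^ n * p ∸ p ^ n * 1   ≡⟨ *-distribˡ-∸ (p ^ n) p 1 ⟨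
  p ^ n * (p ∸ 1)         ∎
  where open ≡-Reasoning

∣totient⇒< : ∀ {p q} → Prime p → Prime q → p ≢ q → ∀ m → p ∣ q ^ m * (q ∸ 1) → p < q
∣totient⇒< {p} {q} p-prime q-prime p≢q m p∣φ = begin-strict
  p       ≤⟨ ∣⇒≤ {{>-nonZero (m<n⇒0<n∸m 1<q)}} (coprime-divisor (coprime-^ m q∤p) p∣φ) ⟩
  q ∸ 1   <⟨ ∸-monoʳ-< {q} {1} {0} (s≤s z≤n) (<⇒≤ 1<q) ⟩
  q       ∎
  where
  open PrimePower q-prime using (coprime-^) renaming (1<p to 1<q)
  open ≤-Reasoning
  q∤p : ¬ q ∣ p
  q∤p q∣p with prime⇒irreducible p-prime q∣p
  ... | inj₁ q≡1 = <-irrefl (sym q≡1) 1<q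
  ... | inj₂ q≡p = p≢q (sym q≡p)

-- For m ≥ 1 both p and q would divide the common value, forcing p < q < p.
totient≡⇔ : ∀ {p q} → Prime p → Prime q → p ≢ q → ∀ n m →
  (p ^ suc (suc n) ∸ p ^ suc n ≡ q ^ suc m ∸ q ^ m) ⇔
  ((q ≡ p ^ suc (suc n) ∸ p ^ suc n + 1) × (suc m ≡ 1))
totient≡⇔ {p} {q} p-prime q-prime p≢q n zero = mk⇔
  (λ φ≡q∸1 → sym (trans (cong (_+ 1) (trans φ≡q∸1 q*1∸1≡q∸1)) (m∸n+n≡m (<⇒≤ 1<q))) , refl)
  (λ (q≡φ+1 , _) → sym (trans q*1∸1≡q∸1 (trans (cong (_∸ 1) q≡φ+1) (m+n∸n≡m _ 1))))
  where
  open PrimePower q-prime using () renaming (1<p to 1<q)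
  q*1∸1≡q∸1 : q * 1 ∸ 1 ≡ q ∸ 1
  q*1∸1≡q∸1 = cong (_∸ 1) (*-identityʳ q)
totient≡⇔ {p} {q} p-prime q-prime p≢q n (suc m) = mk⇔
  (λ φ≡φ → contradiction
    (∣totient⇒< p-prime q-prime p≢q (suc m)
      (subst (p ∣_) (trans φ≡φ (p^[1+n]∸p^n≡p^n*[p∸1] q (suc m))) (p∣φ p n)))
    (<-asym (∣totient⇒< q-prime p-prime (p≢q ∘ sym) (suc n)
      (subst (q ∣_) (trans (sym φ≡φ) (p^[1+n]∸p^n≡p^n*[p∸1] p (suc n))) (p∣φ q m)))))
  (λ (_ , 2+m≡1) → contradiction (suc-injective 2+m≡1) 1+n≢0)
  where
  p∣φ : ∀ p n → p ∣ p ^ suc (suc n) ∸ p ^ suc n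
  p∣φ p n = subst (p ∣_) (sym (p^[1+n]∸p^n≡p^n*[p∸1] p (suc n))) (∣m⇒∣m*n (p ∸ 1) (m∣m*n (p ^ n)))

mainTheorem8 : (p q n m k : ℕ) → (pp : Prime p) → (qq : Prime q) → p ≢ q →
    ¬ (2 ∣ p) → ¬ (2 ∣ q) → 1 ≤ n → 1 ≤ m → (k>0 : k > 0) →
    ((Cl₂ (ZpnZk p n k pp k>0) ≅ Cl₂ (ZpnZk q m k qq k>0))
       ⇔ (p ^ n ∸ p ^ (n ∸ 1) ≡ q ^ m ∸ q ^ (m ∸ 1)))
    × (1 < n →
       ((Cl₂ (ZpnZk p n k pp k>0) ≅ Cl₂ (ZpnZk q m k qq k>0))
          ⇔ ((q ≡ p ^ n ∸ p ^ (n ∸ 1) + 1) × (m ≡ 1))))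
mainTheorem8 p q (suc n) (suc m) k pp qq p≢q p-odd q-odd _ _ k>0 =
  cl₂≅⇔φ≡ , λ { (s≤s (s≤s {n = n′} z≤n)) → totient≡⇔ pp qq p≢q n′ m ⇔-∘ cl₂≅⇔φ≡ }
  where
  instance
    k-nonZero : NonZero k
    k-nonZero = >-nonZero k>0
  module P = ZmodPrimePower pp n
  module Q = ZmodPrimePower qq m
  φp≡ : p ^ suc n ∸ p ^ n ≡ p ^ n * (p ∸ 1)
  φp≡ = p^[1+n]∸p^n≡p^n*[p∸1] p n
  φq≡ : q ^ suc m ∸ q ^ m ≡ q ^ m * (q ∸ 1)
  φq≡ = p^[1+n]∸p^n≡p^n*[p∸1] q m
  cl₂≅⇔φ≡ : (Cl₂ (ZpnZk p (suc n) k pp k>0) ≅ Cl₂ (ZpnZk q (suc m) k qq k>0)) ⇔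
            (p ^ suc n ∸ p ^ n ≡ q ^ suc m ∸ q ^ m)
  cl₂≅⇔φ≡ = mk⇔
    (λ cl₂≅ → subst₂ _≡_ (sym φp≡) (sym φq≡)
      (cl₂-≅⇒unit-counts-≡ P.1<N Q.1<N P.trivialIdempotents Q.trivialIdempotents
        (Zmod k) (cofactor-finite k) (cofactor k) P.units-↔ Q.units-↔ cl₂≅))
    (λ φ≡φ → cl₂-×R-cong P.1<N Q.1<N P.trivialIdempotents Q.trivialIdempotents
      (Zmod k) (unitGraph-≅ pp qq p-odd q-odd n m (subst₂ _≡_ φp≡ φq≡ φ≡φ)))
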